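{- Let $b\ge 2$ be an integer. If $m$ and $x$ are positive integers with $m\geq 4$ and $x<b^{m-1}+h_{m-3}$, then $s_b(x)\leq F_m$.
   Context: Fix an integer $b\ge 2$. A base $b$ over-expansion of a positive integer $N$ is a word $d_kd_{k-1}\cdots d_0$ over $\{0,1,\ldots,b\}$ with $d_k\neq 0$ and $\sum_{i=0}^k d_ib^i=N$. For $n\ge 2$, $s_b(n)$ is the number of base $b$ over-expansions of $n-1$; $s_b(0)=0$, $s_b(1)=1$. The integers $h_m$ are defined by $h_1=h_2=1$ and, for $m\geq 3$, $h_m=1+\sum_{i=0}^{\lfloor (m-3)/2\rfloor}b^{m-2-2i}$. $F_j$ are the Fibonacci numbers with $F_1=F_2=1$. (In the paper's notation, $b^{m-1}+h_{m-3}=G_{m-1}(m-3)$.) -}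

module Defs where

open import Data.Nat using (ℕ; zero; suc; _+_; _*_; _∸_; _^_; _≤_)
open import Data.Nat.DivMod using (_/_)
open import Data.Fin using (Fin; toℕ)
open import Data.List using (List; []; _∷_; foldl; length; map; upTo)
open import Data.Nat.ListAction using (sum)
open import Data.List.Relation.Unary.All using (All)
open import Data.List.Relation.Unary.Unique.Propositional using (Unique)
open import Relation.Binary.PropositionalEquality using (_≡_; _≢_)

-- A word d_k d_{k-1} ... d_0 over the alphabet {0,1,...,b} is a list of
-- elements of Fin (suc b), most significant digit first.
-- Its value is sum_i d_i b^i (Horner evaluation).
value : (b : ℕ) → List (Fin (suc b)) → ℕ
value b = foldl (λ acc d → acc * b + toℕ d) 0

data OverExp (b N : ℕ) : List (Fin (suc b)) → Set where
  overExp : (d : Fin (suc b)) (ds : List (Fin (suc b))) →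
            toℕ d ≢ 0 → value b (d ∷ ds) ≡ N → OverExp b N (d ∷ ds)

-- "the number of base b over-expansions of N is at most k":
-- every duplicate-free list of over-expansions of N has length at most k.
AtMostOverExps : (b N k : ℕ) → Set
AtMostOverExps b N k =
  (ws : List (List (Fin (suc b)))) → Unique ws → All (OverExp b N) ws → length ws ≤ k

-- "s_b(n) ≤ k", with s_b(0) = 0, s_b(1) = 1, and s_b(n) = #over-expansions of n-1 for n ≥ 2.
sbAtMost : (b n k : ℕ) → Set
sbAtMost b zero k = 0 ≤ k
sbAtMost b (suc zero) k = 1 ≤ k
sbAtMost b (suc (suc n)) k = AtMostOverExps b (suc n) k

fib : ℕ → ℕ
fib zero = 0
fib (suc zero) = 1
fib (suc (suc n)) = fib n + fib (suc n)

-- h_1 = h_2 = 1, h_m = 1 + sum_{i=0}^{floor((m-3)/2)} b^(m-2-2i) for m ≥ 3.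
-- (h_0 is never used; we set it to 1 arbitrarily.)
h : (b m : ℕ) → ℕ
h b zero = 1
h b (suc zero) = 1
h b (suc (suc zero)) = 1
h b m@(suc (suc (suc _))) =
  1 + sum (map (λ i → b ^ (m ∸ 2 ∸ 2 * i)) (upTo (suc ((m ∸ 3) / 2))))

-- Splitting off the last digit gives s(qB) = s(q), s(qB + 1) = s(q) + s(q + 1) and
-- s(qB + j) = s(q + 1) for 2 ≤ j ≤ B. So if s(N), s(N + 1) ≤ P and s(N) + s(N + 1) ≤ Q for all
-- N < X, then the same holds with (Q, P + Q) in place of (P, Q) for all N < XB; starting from
-- B³ this gives the Fibonacci bounds. For m = k + 4 the hypothesis reads x ≤ E_k := B^{k+3} + h_{k+1} - 1,
-- and E_{2i+1} = E_{2i} B, E_{2i+2} = (E_{2i+1} + 1) B. The second step also meets the quotient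
-- q = E_{2i+1}, outside the range of the induction hypothesis; there the exact values of s at the
-- thresholds, given by G n = F_{n+1} + 3 F_n (1, 4, 5, 9, 14, …), are used instead.

module Submission where

open import Defs
open import Data.Nat using (ℕ; zero; suc; _+_; _*_; _∸_; _^_; _≤_; _<_; z≤n; s≤s; pred; NonZero)
open import Data.Nat.Properties
open import Data.Nat.DivMod
open import Data.Nat.ListAction using (sum)
open import Data.Nat.Tactic.RingSolver using (solve; solve-∀)
open import Data.Fin using (Fin; zero; suc; toℕ; fromℕ; inject₁)
open import Data.Fin.Properties using (toℕ-injective; toℕ-fromℕ; toℕ-fromℕ<; toℕ-inject₁; toℕ≤pred[n])
open import Data.List using (List; []; _∷_; [_]; _∷ʳ_; _++_; map; length; foldl; upTo)
open import Data.List.Properties using (length-++; length-map; length-removeAt′; foldl-∷ʳ; map-applyUpTo; map-upTo; map-cong)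
open import Data.List.Reverse using (reverseView; []; _∶_∶ʳ_)
import Data.List.Relation.Unary.All as All
open import Data.List.Relation.Unary.Any using (here; there)
open import Data.List.Relation.Unary.Unique.Propositional using (Unique)
open import Data.List.Relation.Unary.Unique.Propositional.Properties using (Unique[x∷xs]⇒x∉xs)
open import Data.List.Relation.Unary.AllPairs using (_∷_)
open import Data.List.Membership.Propositional using (_∈_; _─_)
open import Data.List.Membership.Propositional.Properties using (∈-map⁺; ∈-++⁺ˡ; ∈-++⁺ʳ)
open import Data.List.Relation.Binary.Subset.Propositional using (_⊆_)
open import Data.Product using (_×_; _,_; proj₁; proj₂; ∃₂)
open import Data.Sum using (inj₁; inj₂)
open import Data.Unit using (⊤; tt)
open import Function using (_∘_)
open import Relation.Nullary using (contradiction)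
open import Relation.Binary.PropositionalEquality hiding ([_])

module _ {a} {A : Set a} where

  ∈-─⁺ : ∀ {w z : A} {ys} (p : w ∈ ys) → z ∈ ys → z ≢ w → z ∈ ys ─ p
  ∈-─⁺ (here refl) (here refl) z≢w = contradiction refl z≢w
  ∈-─⁺ (here refl) (there q)   _   = q
  ∈-─⁺ (there p)   (here refl) _   = here refl
  ∈-─⁺ (there p)   (there q)   z≢w = there (∈-─⁺ p q z≢w)

  Unique∧⊆⇒length≤ : ∀ {xs ys : List A} → Unique xs → xs ⊆ ys → length xs ≤ length ys
  Unique∧⊆⇒length≤ {[]}     _ _ = z≤n
  Unique∧⊆⇒length≤ {x ∷ xs} {ys} u@(_ ∷ uxs) x∷xs⊆ys = begin
    suc (length xs)                    ≤⟨ s≤s (Unique∧⊆⇒length≤ uxs xs⊆ys─x) ⟩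
    suc (length (ys ─ x∈ys))           ≡⟨ length-removeAt′ ys _ ⟨
    length ys                          ∎
    where
    open ≤-Reasoning
    x∈ys : x ∈ ys
    x∈ys = x∷xs⊆ys (here refl)
    xs⊆ys─x : xs ⊆ ys ─ x∈ys
    xs⊆ys─x z∈xs = ∈-─⁺ x∈ys (x∷xs⊆ys (there z∈xs))
                          (λ { refl → Unique[x∷xs]⇒x∉xs u z∈xs })

[m+kn]%n≡m : ∀ {m} k {n} .{{_ : NonZero n}} → m < n → (m + k * n) % n ≡ m
[m+kn]%n≡m {m} k {n} m<n = trans ([m+kn]%n≡m%n m k n) (m<n⇒m%n≡m m<n)

[m+kn]/n≡k : ∀ {m} k {n} .{{_ : NonZero n}} → m < n → (m + k * n) / n ≡ k
[m+kn]/n≡k {m} k {n} m<n = begin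
  (m + k * n) / n    ≡⟨ +-distrib-/ m (k * n) remainders<n ⟩
  m / n + k * n / n  ≡⟨ cong₂ _+_ (m<n⇒m/n≡0 m<n) (m*n/n≡m k n) ⟩
  k                  ∎
  where
  open ≡-Reasoning
  remainders<n : m % n + k * n % n < n
  remainders<n = subst (_< n) (sym (trans (cong₂ _+_ (m<n⇒m%n≡m m<n) (m*n%n≡0 k n)) (+-identityʳ m))) m<n

fib-mono : ∀ n → fib n ≤ fib (suc n)
fib-mono zero          = z≤n
fib-mono (suc zero)    = ≤-refl
fib-mono (suc (suc n)) = m≤n+m (fib (suc (suc n))) (fib (suc n))

fib-+ : ∀ m n → fib (suc (m + n)) ≡ fib (suc m) * fib (suc n) + fib m * fib n
fib-+ zero          n = sym (trans (+-identityʳ _) (*-identityˡ _))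
fib-+ (suc zero)    n = swap (fib n) (fib (suc n))
  where
  swap : ∀ u v → u + v ≡ 1 * v + 1 * u
  swap = solve-∀
fib-+ (suc (suc m)) n = trans (cong₂ _+_ (fib-+ m n) (fib-+ (suc m) n))
                              (collect (fib m) (fib (suc m)) (fib n) (fib (suc n)))
  where
  collect : ∀ a b x y → (b * y + a * x) + ((a + b) * y + b * x) ≡ (b + (a + b)) * y + (a + b) * x
  collect = solve-∀

sum-upTo-suc : ∀ (f : ℕ → ℕ) n → sum (map f (upTo (suc n))) ≡ f 0 + sum (map (f ∘ suc) (upTo n))
sum-upTo-suc f n = cong (λ xs → f 0 + sum xs) (trans (map-applyUpTo suc f n) (sym (map-upTo (f ∘ suc) n)))

G : ℕ → ℕ
G n = fib (suc n) + 3 * fib n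

G-rec : ∀ n → G (suc (suc n)) ≡ G n + G (suc n)
G-rec n = rearrange (fib n) (fib (suc n))
  where
  rearrange : ∀ u v → (v + (u + v)) + 3 * (u + v) ≡ (v + 3 * u) + ((u + v) + 3 * v)
  rearrange = solve-∀

double : ℕ → ℕ
double zero    = zero
double (suc i) = suc (suc (double i))

data Parity : ℕ → Set where
  even : ∀ i → Parity (double i)
  odd  : ∀ i → Parity (suc (double i))

parity : ∀ k → Parity k
parity zero = even 0
parity (suc k) with parity k
... | even i = odd i
... | odd i  = even (suc i)

3*fib[2i]≤2*fib[1+2i] : ∀ i → 3 * fib (double i) ≤ 2 * fib (suc (double i))
3*fib[2i]≤2*fib[1+2i] zero    = z≤n
3*fib[2i]≤2*fib[1+2i] (suc i) = ratio (fib (double i)) (fib (suc (double i))) (fib-mono (double i))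
  where
  ratio : ∀ u v → u ≤ v → 3 * (u + v) ≤ 2 * (v + (u + v))
  ratio u v u≤v = begin
    3 * (u + v)          ≡⟨ solve (u ∷ v ∷ []) ⟩
    (2 * u + 3 * v) + u  ≤⟨ +-monoʳ-≤ (2 * u + 3 * v) u≤v ⟩
    (2 * u + 3 * v) + v  ≡⟨ solve (u ∷ v ∷ []) ⟩
    2 * (v + (u + v))    ∎
    where open ≤-Reasoning

threshold-inequalities : ∀ d → 3 * fib d ≤ 2 * fib (suc d) →
    G d + G (2 + d) ≤ fib (6 + d)
  × G d + (G d + G (2 + d)) ≤ fib (7 + d)
  × (G d + G (2 + d)) + G (2 + d) ≤ fib (7 + d)
threshold-inequalities d 3u≤2v =
  let l₁ , l₂ , l₃ = linear (fib d) (fib (suc d)) (fib-mono d) 3u≤2v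
  in ≤-trans l₁ fib₆ , ≤-trans l₂ fib₇ , ≤-trans l₃ fib₇
  where
  fib₆ : 8 * fib (suc d) + 5 * fib d ≤ fib (6 + d)
  fib₆ = ≤-reflexive (sym (fib-+ 5 d))
  fib₇ : 13 * fib (suc d) + 8 * fib d ≤ fib (7 + d)
  fib₇ = ≤-reflexive (sym (fib-+ 6 d))
  linear : ∀ u v → u ≤ v → 3 * u ≤ 2 * v →
      (v + 3 * u) + ((v + (u + v)) + 3 * (u + v)) ≤ 8 * v + 5 * u
    × (v + 3 * u) + ((v + 3 * u) + ((v + (u + v)) + 3 * (u + v))) ≤ 13 * v + 8 * u
    × ((v + 3 * u) + ((v + (u + v)) + 3 * (u + v))) + ((v + (u + v)) + 3 * (u + v)) ≤ 13 * v + 8 * u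
  linear u v u≤v 3u≤2v =
    (begin
      (v + 3 * u) + ((v + (u + v)) + 3 * (u + v))  ≡⟨ solve (u ∷ v ∷ []) ⟩
      (5 * u + 6 * v) + 2 * u                      ≤⟨ +-monoʳ-≤ (5 * u + 6 * v) (*-monoʳ-≤ 2 u≤v) ⟩
      (5 * u + 6 * v) + 2 * v                      ≡⟨ solve (u ∷ v ∷ []) ⟩
      8 * v + 5 * u                                ∎) ,
    (begin
      (v + 3 * u) + ((v + 3 * u) + ((v + (u + v)) + 3 * (u + v)))  ≡⟨ solve (u ∷ v ∷ []) ⟩
      (8 * u + 7 * v) + 2 * u                                      ≤⟨ +-monoʳ-≤ (8 * u + 7 * v) (*-mono-≤ {2} {6} (s≤s (s≤s z≤n)) u≤v) ⟩
      (8 * u + 7 * v) + 6 * v                                      ≡⟨ solve (u ∷ v ∷ []) ⟩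
      13 * v + 8 * u                                               ∎) ,
    (begin
      ((v + 3 * u) + ((v + (u + v)) + 3 * (u + v))) + ((v + (u + v)) + 3 * (u + v))  ≡⟨ solve (u ∷ v ∷ []) ⟩
      (8 * u + 11 * v) + 3 * u                                                        ≤⟨ +-monoʳ-≤ (8 * u + 11 * v) 3u≤2v ⟩
      (8 * u + 11 * v) + 2 * v                                                        ≡⟨ solve (u ∷ v ∷ []) ⟩
      13 * v + 8 * u                                                                  ∎)
    where open ≤-Reasoning

module Expansions (c : ℕ) where

  B : ℕ
  B = 2 + c

  Word : Set
  Word = List (Fin (suc B))

  1<B : 1 < B
  1<B = s≤s (s≤s z≤n)

  extend : Fin B → List Word → List Word → List Word
  extend zero    xs ys = map (_∷ʳ zero) xs ++ map (_∷ʳ fromℕ B) ys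
  extend (suc r) xs ys = map (_∷ʳ inject₁ (suc r)) xs

  -- An over-expansion of N = r + q B (r < B) is one of q followed by the digit r or, when r = 0,
  -- one of q - 1 followed by the digit B. The first argument is fuel; the empty word stands for 0,
  -- so that count 0 = 1 = s_b(1).
  expansions : ℕ → ℕ → List Word
  expansions zero    _       = []
  expansions (suc k) zero    = [ [] ]
  expansions (suc k) (suc n) =
    extend (suc n mod B) (expansions k (suc n / B)) (expansions k (pred (suc n / B)))

  quotient<fuel : ∀ {n k} → suc n ≤ k → suc n / B < k
  quotient<fuel {n} n<k = <-≤-trans (m/n<m (suc n) B 1<B) n<k

  expansions-fuel : ∀ {k k′ N} → N < k → N < k′ → expansions k N ≡ expansions k′ N
  expansions-fuel {suc k} {suc k′} {zero}  _ _ = refl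
  expansions-fuel {suc k} {suc k′} {suc n} (s≤s n<k) (s≤s n<k′) =
    cong₂ (extend (suc n mod B))
      (expansions-fuel (quotient<fuel n<k) (quotient<fuel n<k′))
      (expansions-fuel (≤-<-trans pred[n]≤n (quotient<fuel n<k)) (≤-<-trans pred[n]≤n (quotient<fuel n<k′)))

  count : ℕ → ℕ
  count N = length (expansions (suc N) N)

  length-expansions : ∀ {k N} → N < k → length (expansions k N) ≡ count N
  length-expansions N<k = cong length (expansions-fuel N<k ≤-refl)

  length-extend-zero : ∀ xs ys → length (extend zero xs ys) ≡ length xs + length ys
  length-extend-zero xs ys =
    trans (length-++ (map _ xs)) (cong₂ _+_ (length-map _ xs) (length-map _ ys))

  length-extend-nonzero : ∀ r xs ys → toℕ r ≢ 0 → length (extend r xs ys) ≡ length xs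
  length-extend-nonzero zero    xs ys r≢0 = contradiction refl r≢0
  length-extend-nonzero (suc r) xs ys _   = length-map _ xs

  toℕ-[r+q*B]mod : ∀ q {r} → r < B → toℕ ((r + q * B) mod B) ≡ r
  toℕ-[r+q*B]mod q {r} r<B = trans (toℕ-fromℕ< (m%n<n (r + q * B) B)) ([m+kn]%n≡m q r<B)

  count-nonzero-digit : ∀ q r → suc r < B → count (suc r + q * B) ≡ count q
  count-nonzero-digit q r r<B = begin
    length (extend (N mod B) (expansions N (N / B)) _)  ≡⟨ length-extend-nonzero (N mod B) _ _ N%B≢0 ⟩
    length (expansions N (N / B))                      ≡⟨ cong (length ∘ expansions N) N/B≡q ⟩
    length (expansions N q)                            ≡⟨ length-expansions (subst (_< N) N/B≡q (m/n<m N B 1<B)) ⟩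
    count q                                            ∎
    where
    open ≡-Reasoning
    N : ℕ
    N = suc r + q * B
    N/B≡q : N / B ≡ q
    N/B≡q = [m+kn]/n≡k q r<B
    N%B≢0 : toℕ (N mod B) ≢ 0
    N%B≢0 eq = contradiction (trans (sym (toℕ-[r+q*B]mod q r<B)) eq) λ ()

  count-zero-digit : ∀ q → count (suc q * B) ≡ count (suc q) + count q
  count-zero-digit q = begin
    length (extend (N mod B) (qs (N / B)) (qs (pred (N / B))))  ≡⟨ cong (λ r → length (extend r (qs (N / B)) (qs (pred (N / B))))) N%B≡0 ⟩
    length (extend zero (qs (N / B)) (qs (pred (N / B))))       ≡⟨ length-extend-zero (qs (N / B)) (qs (pred (N / B))) ⟩
    length (qs (N / B)) + length (qs (pred (N / B)))            ≡⟨ cong (λ x → length (qs x) + length (qs (pred x))) N/B≡1+q ⟩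
    length (qs (suc q)) + length (qs q)                         ≡⟨ cong₂ _+_ (length-expansions 1+q<N) (length-expansions q<N) ⟩
    count (suc q) + count q                                     ∎
    where
    open ≡-Reasoning
    N : ℕ
    N = suc q * B
    qs : ℕ → List Word
    qs = expansions N
    N/B≡1+q : N / B ≡ suc q
    N/B≡1+q = [m+kn]/n≡k (suc q) {B} (s≤s z≤n)
    N%B≡0 : N mod B ≡ zero
    N%B≡0 = toℕ-injective (toℕ-[r+q*B]mod (suc q) (s≤s z≤n))
    1+q<N : suc q < N
    1+q<N = subst (_< N) N/B≡1+q (m/n<m N B 1<B)
    q<N : q < N
    q<N = <-trans (n<1+n q) 1+q<N

  Normal : Word → Set
  Normal []      = ⊤
  Normal (d ∷ _) = toℕ d ≢ 0

  Normal-init : ∀ ws e → Normal (ws ∷ʳ e) → Normal ws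
  Normal-init []       e _  = tt
  Normal-init (d ∷ ds) e nz = nz

  value-∷ʳ : ∀ ws e → value B (ws ∷ʳ e) ≡ value B ws * B + toℕ e
  value-∷ʳ ws e = foldl-∷ʳ _ 0 e ws

  push : ℕ → Fin (suc B) → ℕ
  push acc d = acc * B + toℕ d

  foldl-push-mono : ∀ acc ds → acc ≤ foldl push acc ds
  foldl-push-mono acc []       = ≤-refl
  foldl-push-mono acc (d ∷ ds) =
    ≤-trans (≤-trans (m≤m*n acc B) (m≤m+n (acc * B) (toℕ d))) (foldl-push-mono (acc * B + toℕ d) ds)

  value-pos : ∀ ws e → Normal (ws ∷ʳ e) → 0 < value B (ws ∷ʳ e)
  value-pos []       e e≢0 = n≢0⇒n>0 e≢0
  value-pos (d ∷ ds) e d≢0 = ≤-trans (n≢0⇒n>0 d≢0) (foldl-push-mono (toℕ d) (ds ∷ʳ e))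

  ∈-extend : ∀ r (e : Fin (suc B)) {xs ys w} → toℕ e ≡ toℕ r → w ∈ xs → w ∷ʳ e ∈ extend r xs ys
  ∈-extend zero    zero    _  w∈xs = ∈-++⁺ˡ (∈-map⁺ (_∷ʳ zero) w∈xs)
  ∈-extend (suc r) e {xs} {ys} {w} eq w∈xs =
    subst (λ d → w ∷ʳ d ∈ extend (suc r) xs ys) (toℕ-injective (trans (toℕ-inject₁ (suc r)) (sym eq)))
      (∈-map⁺ _ w∈xs)

  ∈-extend-B : ∀ (e : Fin (suc B)) {xs ys w} → toℕ e ≡ B → w ∈ ys → w ∷ʳ e ∈ extend zero xs ys
  ∈-extend-B e {xs} {ys} {w} eq w∈ys =
    subst (λ d → w ∷ʳ d ∈ extend zero xs ys) (toℕ-injective (trans (toℕ-fromℕ B) (sym eq)))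
      (∈-++⁺ʳ (map (_∷ʳ zero) xs) (∈-map⁺ _ w∈ys))

  ∈-expansions-∷ʳ : ∀ {k V w} N (e : Fin (suc B)) → 0 < N → N ≡ V * B + toℕ e → N ≤ k →
                     (V < k → w ∈ expansions k V) → w ∷ʳ e ∈ expansions (suc k) N
  ∈-expansions-∷ʳ {k} {V} {w} (suc n) e _ N≡ N≤k w∈ with m≤n⇒m<n∨m≡n (toℕ≤pred[n] e)
  ... | inj₁ e<B = ∈-extend (suc n mod B) e e≡N%B (subst (λ q → w ∈ expansions k q) (sym N/B≡V) (w∈ V<k))
    where
    N≡e+VB : suc n ≡ toℕ e + V * B
    N≡e+VB = trans N≡ (+-comm (V * B) (toℕ e))
    N/B≡V : suc n / B ≡ V
    N/B≡V = trans (cong (_/ B) N≡e+VB) ([m+kn]/n≡k V e<B)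
    e≡N%B : toℕ e ≡ toℕ (suc n mod B)
    e≡N%B = sym (trans (cong (λ N → toℕ (N mod B)) N≡e+VB) (toℕ-[r+q*B]mod V e<B))
    V<k : V < k
    V<k = subst (_< k) N/B≡V (quotient<fuel N≤k)
  ... | inj₂ e≡B =
    subst (λ r → w ∷ʳ e ∈ extend r (expansions k (suc n / B)) (expansions k (pred (suc n / B)))) (sym N%B≡0)
      (∈-extend-B e e≡B (subst (λ q → w ∈ expansions k (pred q)) (sym N/B≡1+V) (w∈ V<k)))
    where
    N≡[1+V]B : suc n ≡ 0 + suc V * B
    N≡[1+V]B = trans N≡ (trans (cong (V * B +_) e≡B) (+-comm (V * B) B))
    N/B≡1+V : suc n / B ≡ suc V
    N/B≡1+V = trans (cong (_/ B) N≡[1+V]B) ([m+kn]/n≡k (suc V) {B} (s≤s z≤n))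
    N%B≡0 : suc n mod B ≡ zero
    N%B≡0 = toℕ-injective
      (trans (cong (λ N → toℕ (N mod B)) N≡[1+V]B) (toℕ-[r+q*B]mod (suc V) (s≤s z≤n)))
    V<k : V < k
    V<k = <-trans (n<1+n V) (subst (_< k) N/B≡1+V (quotient<fuel N≤k))

  expansions-complete : ∀ k w → Normal w → value B w < k → w ∈ expansions k (value B w)
  expansions-complete (suc k) w nw w<k with reverseView w
  ... | []            = here refl
  ... | ws ∶ _ ∶ʳ e   =
    ∈-expansions-∷ʳ _ e (value-pos ws e nw) (value-∷ʳ ws e) (≤-pred w<k)
      (expansions-complete k ws (Normal-init ws e nw))

  overExp-∈-expansions : ∀ {N w} → OverExp B N w → w ∈ expansions (suc N) N
  overExp-∈-expansions (overExp d ds d≢0 refl) = expansions-complete _ (d ∷ ds) d≢0 ≤-refl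

  atMostOverExps-count : ∀ N → AtMostOverExps B N (count N)
  atMostOverExps-count N ws unique overExps =
    Unique∧⊆⇒length≤ unique (overExp-∈-expansions ∘ All.lookup overExps)

  s : ℕ → ℕ
  s zero    = 0
  s (suc N) = count N

  sbAtMost-s : ∀ x {k} → s x ≤ k → sbAtMost B x k
  sbAtMost-s zero          _   = z≤n
  sbAtMost-s (suc zero)    s≤k = s≤k
  sbAtMost-s (suc (suc n)) s≤k ws unique overExps = ≤-trans (atMostOverExps-count (suc n) ws unique overExps) s≤k

  s[2+j+n*B]≡s[1+n] : ∀ j n → 2 + j ≤ B → s (2 + j + n * B) ≡ s (suc n)
  s[2+j+n*B]≡s[1+n] j n = count-nonzero-digit n j

  s[n*B]≡s[n] : ∀ n → s (n * B) ≡ s n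
  s[n*B]≡s[n] zero    = refl
  s[n*B]≡s[n] (suc n) = s[2+j+n*B]≡s[1+n] c n ≤-refl

  s[1+n*B]≡s[n]+s[1+n] : ∀ n → s (suc (n * B)) ≡ s n + s (suc n)
  s[1+n*B]≡s[n]+s[1+n] zero    = refl
  s[1+n*B]≡s[n]+s[1+n] (suc n) = trans (count-zero-digit n) (+-comm (count (suc n)) (count n))

  s[B^j]≡1 : ∀ j → s (B ^ j) ≡ 1
  s[B^j]≡1 zero    = refl
  s[B^j]≡1 (suc j) = trans (cong s (*-comm B (B ^ j))) (trans (s[n*B]≡s[n] (B ^ j)) (s[B^j]≡1 j))

  s[1+B^j]≡1+j : ∀ j → s (suc (B ^ j)) ≡ suc j
  s[1+B^j]≡1+j zero    = s[2+j+n*B]≡s[1+n] 0 0 (s≤s (s≤s z≤n))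
  s[1+B^j]≡1+j (suc j) =
    trans (cong (s ∘ suc) (*-comm B (B ^ j)))
      (trans (s[1+n*B]≡s[n]+s[1+n] (B ^ j)) (cong₂ _+_ (s[B^j]≡1 j) (s[1+B^j]≡1+j j)))

module Thresholds (c : ℕ) where

  open Expansions c

  Bounded : ℕ → ℕ → ℕ → Set
  Bounded P Q N = s N ≤ P × s (suc N) ≤ P × s N + s (suc N) ≤ Q

  -- With a = s q and b = s (1 + q), the pair (s N, s (1 + N)) for N = r + q B is (a, a + b),
  -- (a + b, b) or (b, b) according as r = 0, r = 1 or r ≥ 2.
  bounded-digit : ∀ {P Q} q r → r < B → s q + s (suc q) ≤ P →
                  s q + (s q + s (suc q)) ≤ Q → (s q + s (suc q)) + s (suc q) ≤ Q →
                  Bounded P Q (r + q * B)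
  bounded-digit q zero _ a+b≤P a+[a+b]≤Q _
    rewrite s[n*B]≡s[n] q | s[1+n*B]≡s[n]+s[1+n] q =
    m+n≤o⇒m≤o (s q) a+b≤P , a+b≤P , a+[a+b]≤Q
  bounded-digit q (suc zero) _ a+b≤P _ [a+b]+b≤Q
    rewrite s[1+n*B]≡s[n]+s[1+n] q | s[2+j+n*B]≡s[1+n] 0 q (s≤s (s≤s z≤n)) =
    a+b≤P , m+n≤o⇒n≤o (s q) a+b≤P , [a+b]+b≤Q
  bounded-digit {P} q (suc (suc r)) r<B a+b≤P _ [a+b]+b≤Q
    rewrite s[2+j+n*B]≡s[1+n] r q (<⇒≤ r<B) | s[2+j+n*B]≡s[1+n] (suc r) q r<B =
    b≤P , b≤P , ≤-trans (+-monoˡ-≤ (s (suc q)) (m≤n+m (s (suc q)) (s q))) [a+b]+b≤Q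
    where
    b≤P : s (suc q) ≤ P
    b≤P = m+n≤o⇒n≤o (s q) a+b≤P

  bounded-step : ∀ {P Q} q r → r < B → Bounded P Q q → Bounded Q (P + Q) (r + q * B)
  bounded-step {P} {Q} q r r<B (a≤P , b≤P , a+b≤Q) =
    bounded-digit q r r<B a+b≤Q (+-mono-≤ a≤P a+b≤Q)
      (≤-trans (+-mono-≤ a+b≤Q b≤P) (≤-reflexive (+-comm Q P)))

  lastDigit : ∀ N → ∃₂ λ q r → r < B × N ≡ r + q * B
  lastDigit N = N / B , N % B , m%n<n N B , m≡m%n+[m/n]*n N B

  r+q*B<X*B⇒q<X : ∀ q r X → r + q * B < X * B → q < X
  r+q*B<X*B⇒q<X q r X r+qB<XB = *-cancelʳ-< B q X (≤-<-trans (m≤n+m (q * B) r) r+qB<XB)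

  bounded-below-power : ∀ j N → N < B ^ j → Bounded (fib (suc j)) (fib (suc (suc j))) N
  bounded-below-power zero    zero    _        = z≤n , ≤-refl , ≤-refl
  bounded-below-power zero    (suc N) (s≤s ())
  bounded-below-power (suc j) N       N<B^[1+j] with lastDigit N
  ... | q , r , r<B , refl =
    bounded-step q r r<B (bounded-below-power j q (r+q*B<X*B⇒q<X q r (B ^ j) N<B^j*B))
    where
    N<B^j*B : r + q * B < B ^ j * B
    N<B^j*B = subst (r + q * B <_) (*-comm B (B ^ j)) N<B^[1+j]

  τ : ℕ → ℕ
  τ zero          = 0
  τ (suc zero)    = 0
  τ (suc (suc k)) = B ^ suc k + τ k

  τ-sum : ∀ j → sum (map (λ i → B ^ (suc j ∸ 2 * i)) (upTo (suc (j / 2)))) ≡ τ (2 + j)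
  τ-sum zero          = refl
  τ-sum (suc zero)    = refl
  τ-sum (suc (suc j)) = begin
    sum (map F (upTo (suc ((2 + j) / 2))))          ≡⟨ cong (λ n → sum (map F (upTo (suc n)))) (m/n≡1+[m∸n]/n {2 + j} {2} (s≤s (s≤s z≤n))) ⟩
    sum (map F (upTo (suc (suc (j / 2)))))          ≡⟨ sum-upTo-suc F (suc (j / 2)) ⟩
    F 0 + sum (map (F ∘ suc) (upTo (suc (j / 2))))  ≡⟨ cong (λ xs → F 0 + sum xs) (map-cong F∘suc≗F′ (upTo (suc (j / 2)))) ⟩
    F 0 + sum (map F′ (upTo (suc (j / 2))))         ≡⟨ cong (F 0 +_) (τ-sum j) ⟩
    τ (4 + j)                                       ∎
    where
    open ≡-Reasoning
    F F′ : ℕ → ℕ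
    F  i = B ^ (3 + j ∸ 2 * i)
    F′ i = B ^ (1 + j ∸ 2 * i)
    F∘suc≗F′ : ∀ i → F (suc i) ≡ F′ i
    F∘suc≗F′ i = cong (λ e → B ^ (3 + j ∸ e)) (*-suc 2 i)

  h≡1+τ : ∀ k → h B (suc k) ≡ suc (τ k)
  h≡1+τ zero          = refl
  h≡1+τ (suc zero)    = refl
  h≡1+τ (suc (suc j)) = cong suc (τ-sum j)

  threshold : ℕ → ℕ
  threshold k = B ^ (3 + k) + τ k

  private
    factor : ∀ x t b → b * x + t * b ≡ (x + t) * b
    factor = solve-∀

    factor-suc : ∀ x t b → b * x + (1 + t) * b ≡ (1 + (x + t)) * b
    factor-suc = solve-∀

  τ-odd : ∀ i → τ (suc (double i)) ≡ τ (double i) * B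
  τ-odd zero    = refl
  τ-odd (suc i) = trans (cong (B ^ (2 + double i) +_) (τ-odd i)) (factor (B ^ (1 + double i)) (τ (double i)) B)

  τ-even : ∀ i → τ (double (suc i)) ≡ suc (τ (suc (double i))) * B
  τ-even zero    = factor 1 0 B
  τ-even (suc i) = trans (cong (B ^ (3 + double i) +_) (τ-even i))
    (factor-suc (B ^ (2 + double i)) (τ (suc (double i))) B)

  threshold-odd : ∀ i → threshold (suc (double i)) ≡ threshold (double i) * B
  threshold-odd i = trans (cong (B ^ (4 + double i) +_) (τ-odd i)) (factor (B ^ (3 + double i)) (τ (double i)) B)

  threshold-even : ∀ i → threshold (double (suc i)) ≡ suc (threshold (suc (double i))) * B
  threshold-even i = trans (cong (B ^ (5 + double i) +_) (τ-even i))
    (factor-suc (B ^ (4 + double i)) (τ (suc (double i))) B)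

  Boundary : ℕ → Set
  Boundary i = s (threshold (double i)) ≡ G (double i) × s (suc (threshold (double i))) ≡ G (suc (double i))

  boundary-zero : Boundary 0
  boundary-zero = trans (cong s (+-identityʳ (B ^ 3))) (s[B^j]≡1 3)
                , trans (cong (s ∘ suc) (+-identityʳ (B ^ 3))) (s[1+B^j]≡1+j 3)

  boundary-odd : ∀ i → Boundary i →
      s (threshold (suc (double i))) ≡ G (double i)
    × s (suc (threshold (suc (double i)))) ≡ G (2 + double i)
    × s (2 + threshold (suc (double i))) ≡ G (suc (double i))
  boundary-odd i (sE≡ , s[1+E]≡) rewrite threshold-odd i =
      trans (s[n*B]≡s[n] E) sE≡
    , trans (s[1+n*B]≡s[n]+s[1+n] E) (trans (cong₂ _+_ sE≡ s[1+E]≡) (sym (G-rec (double i))))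
    , trans (s[2+j+n*B]≡s[1+n] 0 E (s≤s (s≤s z≤n))) s[1+E]≡
    where
    E : ℕ
    E = threshold (double i)

  boundary-suc : ∀ i → Boundary i → Boundary (suc i)
  boundary-suc i boundary rewrite threshold-even i =
      trans (s[n*B]≡s[n] (suc E)) s[1+E]≡
    , trans (s[1+n*B]≡s[n]+s[1+n] (suc E))
        (trans (cong₂ _+_ s[1+E]≡ s[2+E]≡) (trans (+-comm (G (2 + double i)) _) (sym (G-rec (suc (double i))))))
    where
    E : ℕ
    E = threshold (suc (double i))
    s[1+E]≡ : s (suc E) ≡ G (2 + double i)
    s[1+E]≡ = proj₁ (proj₂ (boundary-odd i boundary))
    s[2+E]≡ : s (2 + E) ≡ G (suc (double i))
    s[2+E]≡ = proj₂ (proj₂ (boundary-odd i boundary))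

  BoundedBelowThreshold : ℕ → Set
  BoundedBelowThreshold k = ∀ N → N < threshold k → Bounded (fib (4 + k)) (fib (5 + k)) N

  bounded-below-threshold-zero : BoundedBelowThreshold 0
  bounded-below-threshold-zero N N<E = bounded-below-power 3 N (subst (N <_) (+-identityʳ (B ^ 3)) N<E)

  bounded-odd : ∀ i → BoundedBelowThreshold (double i) → BoundedBelowThreshold (suc (double i))
  bounded-odd i bounded N N<E with lastDigit N
  ... | q , r , r<B , refl =
    bounded-step q r r<B (bounded q (r+q*B<X*B⇒q<X q r _ (subst (r + q * B <_) (threshold-odd i) N<E)))

  bounded-even : ∀ i → BoundedBelowThreshold (suc (double i)) → Boundary i →
                 BoundedBelowThreshold (double (suc i))
  bounded-even i bounded boundary N N<E with lastDigit N
  ... | q , r , r<B , refl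
    with m<1+n⇒m<n∨m≡n (r+q*B<X*B⇒q<X q r _ (subst (r + q * B <_) (threshold-even i) N<E))
  ...   | inj₁ q<E = bounded-step q r r<B (bounded q q<E)
  ...   | inj₂ refl = let h₁ , h₂ , h₃ = at-boundary in bounded-digit E r r<B h₁ h₂ h₃
    where
    E : ℕ
    E = threshold (suc (double i))
    at-boundary : s E + s (suc E) ≤ fib (6 + double i)
                × s E + (s E + s (suc E)) ≤ fib (7 + double i)
                × (s E + s (suc E)) + s (suc E) ≤ fib (7 + double i)
    at-boundary rewrite proj₁ (boundary-odd i boundary) | proj₁ (proj₂ (boundary-odd i boundary)) =
      threshold-inequalities (double i) (3*fib[2i]≤2*fib[1+2i] i)

  bounded-below-even-threshold : ∀ i → BoundedBelowThreshold (double i) × Boundary i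
  bounded-below-even-threshold zero    = bounded-below-threshold-zero , boundary-zero
  bounded-below-even-threshold (suc i) =
    let bounded , boundary = bounded-below-even-threshold i
    in bounded-even i (bounded-odd i bounded) boundary , boundary-suc i boundary

  bounded-below-threshold : ∀ k → BoundedBelowThreshold k
  bounded-below-threshold k with parity k
  ... | even i = proj₁ (bounded-below-even-threshold i)
  ... | odd i  = bounded-odd i (proj₁ (bounded-below-even-threshold i))

  s≤fib : ∀ k x → 1 ≤ x → x < B ^ (3 + k) + h B (suc k) → s x ≤ fib (4 + k)
  s≤fib k (suc N) _ x<bound = proj₁ (proj₂ (bounded-below-threshold k N N<E))
    where
    N<E : N < threshold k
    N<E = ≤-pred (subst (suc N <_) (trans (cong (B ^ (3 + k) +_) (h≡1+τ k)) (+-suc (B ^ (3 + k)) (τ k))) x<bound)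

lemma27 : (b m x : ℕ) → 2 ≤ b → 4 ≤ m → 1 ≤ x →
          x < b ^ (m ∸ 1) + h b (m ∸ 3) → sbAtMost b x (fib m)
lemma27 zero          _ _ ()                _                             _ _
lemma27 (suc zero)    _ _ (s≤s ())          _                             _ _
lemma27 (suc (suc c)) (suc (suc (suc (suc k)))) x _ _ 1≤x x<bound =
  Expansions.sbAtMost-s c x (Thresholds.s≤fib c k x 1≤x x<bound)
lemma27 (suc (suc c)) zero                      _ _ ()                            _ _
lemma27 (suc (suc c)) (suc zero)                _ _ (s≤s ())                      _ _
lemma27 (suc (suc c)) (suc (suc zero))          _ _ (s≤s (s≤s ()))                _ _
lemma27 (suc (suc c)) (suc (suc (suc zero)))    _ _ (s≤s (s≤s (s≤s ())))          _ _
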